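{- Let $A$ be a modal formula and $\mathcal{F} = (W, \{\prec_B\}_B)$ an $\mathbf{N}$-frame. If $\mathcal{F}$ is $A$-transitive, then $\Box A \to \Box\Box A$ is valid in $\mathcal{F}$.
   Context: Modal formulas are built from propositional variables and $\bot$ using $\neg,\land,\lor,\to$ and $\Box$. An $\mathbf{N}$-frame is $(W, \{\prec_B\}_B)$ with $W$ nonempty and a binary relation $\prec_B$ on $W$ for each modal formula $B$; an $\mathbf{N}$-model adds $\Vdash$ with usual propositional clauses and $x\Vdash\Box B$ iff $y\Vdash B$ for all $y$ with $x\prec_B y$. A formula is valid in a frame if it holds at every world of every model based on the frame. $\mathcal{F}$ is $A$-transitive if for all $x,y,z\in W$, $x \prec_{\Box A} y$ and $y \prec_A z$ imply $x \prec_A z$. -}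

module Defs where

open import Data.Nat using (ℕ)
open import Data.Product using (_×_)
open import Data.Sum using (_⊎_)
open import Data.Empty using (⊥)
open import Relation.Nullary using (¬_)

data Formula : Set where
  var  : ℕ → Formula
  fals : Formula
  neg  : Formula → Formula
  _∧_  : Formula → Formula → Formula
  _∨_  : Formula → Formula → Formula
  _⇒_  : Formula → Formula → Formula
  □_   : Formula → Formula

infixr 6 _∧_
infixr 5 _∨_
infixr 4 _⇒_
infix 7 □_

record NFrame : Set₁ where
  field
    W        : Set
    inhabitant : W
    R        : Formula → W → W → Set

record NModel (F : NFrame) : Set₁ where
  field
    V : ℕ → NFrame.W F → Set

_,_⊩_ : {F : NFrame} → NModel F → NFrame.W F → Formula → Set
M , x ⊩ var p   = NModel.V M p x
M , x ⊩ fals    = ⊥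
M , x ⊩ neg A   = ¬ (M , x ⊩ A)
M , x ⊩ (A ∧ B) = (M , x ⊩ A) × (M , x ⊩ B)
M , x ⊩ (A ∨ B) = (M , x ⊩ A) ⊎ (M , x ⊩ B)
M , x ⊩ (A ⇒ B) = (M , x ⊩ A) → (M , x ⊩ B)
_,_⊩_ {F} M x (□ A) = ∀ y → NFrame.R F A x y → M , y ⊩ A

ValidIn : Formula → NFrame → Set₁
ValidIn A F = (M : NModel F) (x : NFrame.W F) → M , x ⊩ A

ATransitive : Formula → NFrame → Set
ATransitive A F = ∀ x y z → NFrame.R F (□ A) x y → NFrame.R F A y z → NFrame.R F A x z

module Submission where

open import Defs

proposition3p9 : (A : Formula) (F : NFrame) → ATransitive A F → ValidIn (□ A ⇒ □ □ A) F
proposition3p9 A F trans M x x⊩□A y x≺□Ay z y≺Az = x⊩□A z (trans x y z x≺□Ay y≺Az)
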